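{- Let $\mathit{AP} = I \cup O$ be a finite set of atomic propositions with $I$ (inputs, controlled by the environment) and $O$ (outputs) disjoint, let $\Sigma = 2^{\mathit{AP}}$, let $\varphi \subseteq \Sigma^\omega$ be a linear-time property, and let $k \in \mathbb{N}$. Then for every $2^O$-labeled $2^I$-transition system $\mathcal{T}$: (1) if $L_{\mathcal{E}}(\mathcal{T}) \subseteq \varphi$ for all environments $\mathcal{E}$ with at most $k$ states, then $\mathcal{T} \models_{k,I} \varphi$; (2) if $\mathcal{T} \models_{k\cdot|\mathcal{T}|,I} \varphi$, then $L_{\mathcal{E}}(\mathcal{T}) \subseteq \varphi$ for all environments $\mathcal{E}$ with at most $k$ states.
   Context: A $2^O$-labeled $2^I$-transition system is $\mathcal{T} = (T, t_0, \tau, o)$ with finite state set $T$, initial state $t_0$, transition function $\tau : T \times 2^I \to T$, and labeling $o : T \to 2^O$; its size is $|\mathcal{T}| = |T|$. An initial path is a sequence $(t_0,e_0)(t_1,e_1)\dots$ with $e_i \in 2^I$ and $t_{i+1} = \tau(t_i,e_i)$; its trace is $(o(t_0)\cup e_0)(o(t_1)\cup e_1)\dots \in \Sigma^\omega$, and $L(\mathcal{T})$ is the set of all traces. An environment is a $2^I$-labeled $2^O$-transition system $\mathcal{E} = (E, s_0, \rho, \iota)$ with $\rho : E \times 2^O \to E$, $\iota : E \to 2^I$; its size is $|E|$. $L_{\mathcal{E}}(\mathcal{T})$ is the set of $\sigma = \sigma_0\sigma_1\dots \in L(\mathcal{T})$ for which there is a sequence $s_0 s_1 \dots$ of states of $\mathcal{E}$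 starting at the initial state with $s_{i+1} = \rho(s_i, \sigma_{i+1}\cap O)$ and $\sigma_i \cap I = \iota(s_i)$ for all $i$. For $\sigma \in \Sigma^\omega$, $\sigma|_I$ is its projection onto $I$. For a set $L \subseteq \Sigma^\omega$ and $k \in \mathbb{N}$, $L_k^I(L)$ is the set of $\sigma \in L$ such that there exist $u \in (2^I)^*$, $v \in (2^I)^+$ with $|u\cdot v| = k$ and $\sigma|_I = u\cdot v^\omega$. We write $\mathcal{T} \models_{k,I} \varphi$ ($\mathcal{T}$ is a $k$-lasso-precise implementation of $\varphi$) iff $L_k^I(L(\mathcal{T})) \subseteq \varphi$. -}

module Defs where

open import Data.Nat using (ℕ; zero; suc; _+_; _∸_; _%_; _<?_; _≤_)
open import Relation.Nullary using (yes; no)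
open import Data.Bool using (Bool; if_then_else_)
open import Data.Fin using (Fin; fromℕ<)
open import Data.Vec using (Vec; lookup)
open import Data.Nat.DivMod using (m%n<n)
open import Data.Product using (Σ; _×_; _,_; proj₁; proj₂; ∃)
open import Relation.Binary.PropositionalEquality using (_≡_)

-- Atomic propositions: I = Fin m (inputs), O = Fin n (outputs), disjoint,
-- AP = I ⊎ O.  A subset of I is a Bool-vector of length m (2^I), similarly 2^O.
Inputs : ℕ → Set
Inputs m = Vec Bool m

Outputs : ℕ → Set
Outputs n = Vec Bool n

-- Σ = 2^AP = 2^(I ⊎ O) ≅ 2^I × 2^O  (I, O disjoint).
-- A letter σ is the pair (σ ∩ I , σ ∩ O).
Letter : ℕ → ℕ → Set
Letter m n = Inputs m × Outputs n

inp : ∀ {m n} → Letter m n → Inputs m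
inp = proj₁

out : ∀ {m n} → Letter m n → Outputs n
out = proj₂

Word : ℕ → ℕ → Set
Word m n = ℕ → Letter m n

Property : ℕ → ℕ → Set₁
Property m n = Word m n → Set

_⊆_ : ∀ {m n} → Property m n → Property m n → Set
A ⊆ B = ∀ σ → A σ → B σ

record TS (m n N : ℕ) : Set where
  field
    t₀ : Fin N
    τ  : Fin N → Inputs m → Fin N
    o  : Fin N → Outputs n

record Env (m n M : ℕ) : Set where
  field
    s₀ : Fin M
    ρ  : Fin M → Outputs n → Fin M
    ι  : Fin M → Inputs m

run : ∀ {m n N} → TS m n N → (ℕ → Inputs m) → ℕ → Fin N
run T e zero    = TS.t₀ T
run T e (suc i) = TS.τ T (run T e i) (e i)

L : ∀ {m n N} → TS m n N → Property m n
L {m} T σ = Σ (ℕ → Inputs m) λ e →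
  ∀ i → σ i ≡ (e i , TS.o T (run T e i))

L[_] : ∀ {m n N M} → Env m n M → TS m n N → Property m n
L[_] {M = M} E T σ = L T σ × Σ (ℕ → Fin M) λ s →
  (s 0 ≡ Env.s₀ E) ×
  (∀ i → s (suc i) ≡ Env.ρ E (s i) (out (σ (suc i)))) ×
  (∀ i → inp (σ i) ≡ Env.ι E (s i))

-- the ω-word u · v^ω (u of length a, v of length suc b ≥ 1), at position i
lasso : ∀ {A : Set} {a b} → Vec A a → Vec A (suc b) → ℕ → A
lasso {a = a} {b} u v i with i <? a
... | yes i<a = lookup u (fromℕ< i<a)
... | no  _   = lookup v (fromℕ< (m%n<n (i ∸ a) (suc b)))

Lasso : ∀ {m n} → ℕ → Property m n → Property m n
Lasso {m} k P σ = P σ × Σ ℕ λ a → Σ ℕ λ b →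
  (a + suc b ≡ k) × Σ (Vec (Inputs m) a) λ u → Σ (Vec (Inputs m) (suc b)) λ v →
  ∀ i → inp (σ i) ≡ lasso u v i

_⊨[_]_ : ∀ {m n N} → TS m n N → ℕ → Property m n → Set
T ⊨[ k ] φ = Lasso k (L T) ⊆ φ

-- (1) A lasso u · v^ω of length k is read by a k-state environment that just counts positions,
-- wrapping from the end of v back to its start. (2) A system with N states in closed loop with an
-- environment with M ≤ k states is deterministic with at most k · N joint states, so its joint run
-- repeats within k · N steps and is periodic from there on; the inputs, read off the environment
-- state, therefore form a lasso of length k · N.
module Submission where

open import Defs
open import Data.Nat using (ℕ; zero; suc; _+_; _*_; _∸_; _%_; _/_; _≤_; _<_; _<?_; z≤n; s≤s; s≤s⁻¹)
open import Data.Nat.Properties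
open import Data.Nat.DivMod using (m%n<n; m≡m%n+[m/n]*n; [m+n]%n≡m%n)
open import Data.Product using (Σ; _×_; _,_; proj₁; proj₂)
open import Data.Fin using (Fin; toℕ; fromℕ<; combine)
open import Data.Fin.Properties using (toℕ-fromℕ<; fromℕ<-cong; toℕ<n; pigeonhole; combine-injective)
open import Data.Vec using (Vec; lookup; tabulate)
open import Data.Vec.Properties using (lookup∘tabulate)
open import Relation.Nullary using (yes; no)
open import Relation.Nullary.Negation using (contradiction)
open import Function using (_∘_)
open import Relation.Binary.PropositionalEquality
open ≡-Reasoning

private variable
  A : Set

EventuallyPeriodic : (ℕ → A) → ℕ → ℕ → Set
EventuallyPeriodic w a p = ∀ t → a ≤ t → w (t + p) ≡ w t

eventuallyPeriodic-iterate : {w : ℕ → A} {a p : ℕ} → EventuallyPeriodic w a p →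
  ∀ c t → a ≤ t → w (t + c * p) ≡ w t
eventuallyPeriodic-iterate {w = w} per zero t a≤t = cong w (+-identityʳ t)
eventuallyPeriodic-iterate {w = w} {p = p} per (suc c) t a≤t = begin
  w (t + (p + c * p))  ≡⟨ cong w (trans (cong (t +_) (+-comm p (c * p))) (sym (+-assoc t (c * p) p))) ⟩
  w (t + c * p + p)    ≡⟨ per (t + c * p) (≤-trans a≤t (m≤m+n t (c * p))) ⟩
  w (t + c * p)        ≡⟨ eventuallyPeriodic-iterate per c t a≤t ⟩
  w t                  ∎

deterministic⇒eventuallyPeriodic : (f : ℕ → A) → (∀ i j → f i ≡ f j → f (suc i) ≡ f (suc j)) →
  ∀ {a p} → f (a + p) ≡ f a → EventuallyPeriodic f a p
deterministic⇒eventuallyPeriodic f step {a} {p} loop t a≤t =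
  subst (λ x → f (x + p) ≡ f x) (m∸n+n≡m a≤t) (shifted (t ∸ a))
  where
  shifted : ∀ d → f (d + a + p) ≡ f (d + a)
  shifted zero    = loop
  shifted (suc d) = step _ _ (shifted d)

IsLasso : ℕ → (ℕ → A) → Set
IsLasso {A} k w = Σ ℕ λ a → Σ ℕ λ b → (a + suc b ≡ k) ×
  Σ (Vec A a) λ u → Σ (Vec A (suc b)) λ v → ∀ i → w i ≡ lasso u v i

lasso-eventuallyPeriodic : ∀ {a b} (u : Vec A a) (v : Vec A (suc b)) →
  EventuallyPeriodic (lasso u v) a (suc b)
lasso-eventuallyPeriodic {a = a} {b} u v t a≤t with t + suc b <? a | t <? a
... | yes t+p<a | _       = contradiction t+p<a (≤⇒≯ (≤-trans a≤t (m≤m+n t (suc b))))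
... | no _      | yes t<a = contradiction t<a (≤⇒≯ a≤t)
... | no _      | no _    = cong (lookup v) (fromℕ<-cong _ _ same-residue _ _)
  where
  same-residue : (t + suc b ∸ a) % suc b ≡ (t ∸ a) % suc b
  same-residue = trans (cong (_% suc b) (+-∸-comm (suc b) a≤t)) ([m+n]%n≡m%n (t ∸ a) (suc b))

lookup-tabulate-fromℕ< : ∀ {n} (f : ℕ → A) {i} (i<n : i < n) →
  lookup (tabulate (λ j → f (toℕ j))) (fromℕ< i<n) ≡ f i
lookup-tabulate-fromℕ< f i<n = trans (lookup∘tabulate _ (fromℕ< i<n)) (cong f (toℕ-fromℕ< i<n))

eventuallyPeriodic≡lasso : {w : ℕ → A} {a b : ℕ} → EventuallyPeriodic w a (suc b) →
  ∀ a′ → a ≤ a′ → ∀ x →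
  w x ≡ lasso {a = a′} {b = b} (tabulate (λ j → w (toℕ j))) (tabulate (λ j → w (a′ + toℕ j))) x
eventuallyPeriodic≡lasso {w = w} {a} {b} per a′ a≤a′ x with x <? a′
... | yes x<a′ = sym (lookup-tabulate-fromℕ< w x<a′)
... | no x≮a′  = begin
  w x                    ≡⟨ cong w (sym a′+r+q*p≡x) ⟩
  w (a′ + r + q * suc b) ≡⟨ eventuallyPeriodic-iterate per q (a′ + r) (≤-trans a≤a′ (m≤m+n a′ r)) ⟩
  w (a′ + r)             ≡⟨ lookup-tabulate-fromℕ< (λ j → w (a′ + j)) (m%n<n (x ∸ a′) (suc b)) ⟨
  _                      ∎
  where
  r = (x ∸ a′) % suc b
  q = (x ∸ a′) / suc b
  a′+r+q*p≡x : a′ + r + q * suc b ≡ x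
  a′+r+q*p≡x = begin
    a′ + r + q * suc b   ≡⟨ +-assoc a′ r (q * suc b) ⟩
    a′ + (r + q * suc b) ≡⟨ cong (a′ +_) (m≡m%n+[m/n]*n (x ∸ a′) (suc b)) ⟨
    a′ + (x ∸ a′)        ≡⟨ m+[n∸m]≡n (≮⇒≥ x≮a′) ⟩
    x                    ∎

-- The prefix is lengthened to k ∸ p, which is harmless because periodicity already holds from a.
eventuallyPeriodic⇒isLasso : {w : ℕ → A} {a b k : ℕ} →
  EventuallyPeriodic w a (suc b) → a + suc b ≤ k → IsLasso k w
eventuallyPeriodic⇒isLasso {a = a} {b} {k} per a+p≤k =
  k ∸ suc b , b , m∸n+n≡m (≤-trans (m≤n+m (suc b) a) a+p≤k) , _ , _ ,
  eventuallyPeriodic≡lasso per (k ∸ suc b) (m+n≤o⇒m≤o∸n a a+p≤k)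

SameSuffix : (ℕ → A) → ℕ → ℕ → Set
SameSuffix w t t′ = ∀ d → w (d + t) ≡ w (d + t′)

sameSuffix-suc : {w : ℕ → A} {t t′ : ℕ} → SameSuffix w t t′ → SameSuffix w (suc t) (suc t′)
sameSuffix-suc {w = w} {t} {t′} same d = begin
  w (d + suc t)  ≡⟨ cong w (+-suc d t) ⟩
  w (suc d + t)  ≡⟨ same (suc d) ⟩
  w (suc d + t′) ≡⟨ cong w (+-suc d t′) ⟨
  w (d + suc t′) ∎

-- A counter over positions 0 … a + b that jumps back to a and ignores the system's outputs.
start : ∀ {a b} → Fin (a + suc b)
start {a} {b} = fromℕ< (≤-trans (s≤s z≤n) (m≤n+m (suc b) a))

tick : ∀ {a b} → Fin (a + suc b) → Fin (a + suc b)
tick {a} {b} j with suc (toℕ j) <? a + suc b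
... | yes j+1<k = fromℕ< j+1<k
... | no _      = fromℕ< (m<m+n a (s≤s z≤n))

ticks : ∀ a b → ℕ → Fin (a + suc b)
ticks a b zero    = start
ticks a b (suc i) = tick (ticks a b i)

counter : ∀ {m n} → (ℕ → Inputs m) → ∀ a b → Env m n (a + suc b)
counter w a b = record { s₀ = start ; ρ = λ j _ → tick j ; ι = λ j → w (toℕ j) }

tick-sameSuffix : {w : ℕ → A} {a b : ℕ} → EventuallyPeriodic w a (suc b) →
  (j : Fin (a + suc b)) → SameSuffix w (toℕ (tick j)) (suc (toℕ j))
tick-sameSuffix {w = w} {a} {b} per j with suc (toℕ j) <? a + suc b
... | yes j+1<k = λ d → cong (λ x → w (d + x)) (toℕ-fromℕ< j+1<k)
... | no j+1≮k = λ d → begin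
  w (d + toℕ (fromℕ< (m<m+n a (s≤s z≤n)))) ≡⟨ cong (λ x → w (d + x)) (toℕ-fromℕ< _) ⟩
  w (d + a)                                ≡⟨ per (d + a) (m≤n+m a d) ⟨
  w (d + a + suc b)                        ≡⟨ cong w (+-assoc d a (suc b)) ⟩
  w (d + (a + suc b))                      ≡⟨ cong (λ x → w (d + x)) (≤-antisym (toℕ<n j) (≮⇒≥ j+1≮k)) ⟨
  w (d + suc (toℕ j))                      ∎

ticks-sameSuffix : {w : ℕ → A} {a b : ℕ} → EventuallyPeriodic w a (suc b) →
  ∀ i → SameSuffix w (toℕ (ticks a b i)) i
ticks-sameSuffix {w = w} per zero d = cong (λ x → w (d + x)) (toℕ-fromℕ< _)
ticks-sameSuffix {w = w} {a} {b} per (suc i) d =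
  trans (tick-sameSuffix per (ticks a b i) d) (sameSuffix-suc {w = w} (ticks-sameSuffix per i) d)

boundedEnvironments⇒lassoPrecise : ∀ {m n N} (φ : Property m n) (k : ℕ) (T : TS m n N) →
  (∀ M → M ≤ k → (E : Env m n M) → L[ E ] T ⊆ φ) → T ⊨[ k ] φ
boundedEnvironments⇒lassoPrecise φ _ T safe σ (σ∈T , a , b , refl , u , v , σ≡uvω) =
  safe (a + suc b) ≤-refl (counter (lasso u v) a b) σ
    (σ∈T , ticks a b , refl , (λ _ → refl) , λ i →
      trans (σ≡uvω i) (sym (ticks-sameSuffix (lasso-eventuallyPeriodic u v) i 0)))

repetition-within : ∀ {c k} (f : ℕ → Fin c) → c ≤ k →
  Σ ℕ λ i → Σ ℕ λ b → (i + suc b ≤ k) × (f (i + suc b) ≡ f i)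
repetition-within {k = k} f c≤k with pigeonhole (s≤s c≤k) (λ (x : Fin (suc k)) → f (toℕ x))
... | x , y , x<y , fx≡fy with m≤n⇒∃[o]m+o≡n x<y
... | b , x+1+b≡y = toℕ x , b , subst (_≤ k) (sym x+p≡y) (s≤s⁻¹ (toℕ<n y)) ,
                    trans (cong f x+p≡y) (sym fx≡fy)
  where
  x+p≡y : toℕ x + suc b ≡ toℕ y
  x+p≡y = trans (+-suc (toℕ x) b) x+1+b≡y

closedLoop-deterministic : ∀ {m n N M} (T : TS m n N) (E : Env m n M)
  (e : ℕ → Inputs m) (s : ℕ → Fin M) →
  (∀ i → e i ≡ Env.ι E (s i)) →
  (∀ i → s (suc i) ≡ Env.ρ E (s i) (TS.o T (run T e (suc i)))) →
  ∀ i j → (run T e i , s i) ≡ (run T e j , s j) →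
  (run T e (suc i) , s (suc i)) ≡ (run T e (suc j) , s (suc j))
closedLoop-deterministic T E e s reads moves i j same = cong₂ _,_ run≡ (begin
  s (suc i)                         ≡⟨ moves i ⟩
  ρ (s i) (o (run T e (suc i)))     ≡⟨ cong₂ ρ s≡ (cong o run≡) ⟩
  ρ (s j) (o (run T e (suc j)))     ≡⟨ moves j ⟨
  s (suc j)                         ∎)
  where
  open TS T using (τ; o)
  open Env E using (ρ; ι)
  s≡ : s i ≡ s j
  s≡ = cong proj₂ same
  run≡ : run T e (suc i) ≡ run T e (suc j)
  run≡ = cong₂ τ (cong proj₁ same) (begin
    e i     ≡⟨ reads i ⟩
    ι (s i) ≡⟨ cong ι s≡ ⟩
    ι (s j) ≡⟨ reads j ⟨
    e j     ∎)

lassoPrecise⇒boundedEnvironments : ∀ {m n N} (φ : Property m n) (k : ℕ) (T : TS m n N) →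
  T ⊨[ k * N ] φ → ∀ M → M ≤ k → (E : Env m n M) → L[ E ] T ⊆ φ
lassoPrecise⇒boundedEnvironments {N = N} φ k T precise M M≤k E σ
  (σ∈T@(e , σ≡) , s , _ , moves , reads)
  with repetition-within (λ i → combine (s i) (run T e i)) (*-monoˡ-≤ N M≤k)
... | i , b , i+p≤kN , loop with combine-injective _ _ _ _ loop
... | s≡ , run≡ = precise σ (σ∈T , eventuallyPeriodic⇒isLasso inputs-periodic i+p≤kN)
  where
  open Env E using (ρ; ι)
  e≡ι : ∀ t → e t ≡ ι (s t)
  e≡ι t = trans (cong proj₁ (sym (σ≡ t))) (reads t)

  joint-periodic : EventuallyPeriodic (λ t → run T e t , s t) i (suc b)
  joint-periodic = deterministic⇒eventuallyPeriodic _
    (closedLoop-deterministic T E e s e≡ι λ t → trans (moves t) (cong (ρ (s t) ∘ proj₂) (σ≡ (suc t))))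
    (cong₂ _,_ run≡ s≡)

  inputs-periodic : EventuallyPeriodic (λ t → inp (σ t)) i (suc b)
  inputs-periodic t i≤t = begin
    inp (σ (t + suc b)) ≡⟨ reads (t + suc b) ⟩
    ι (s (t + suc b))   ≡⟨ cong (ι ∘ proj₂) (joint-periodic t i≤t) ⟩
    ι (s t)             ≡⟨ reads t ⟨
    inp (σ t)           ∎

proposition1 : (m n : ℕ) (φ : Property m n) (k : ℕ) (N : ℕ) (T : TS m n N) →
    ((∀ (M : ℕ) → M ≤ k → (E : Env m n M) → L[ E ] T ⊆ φ) → T ⊨[ k ] φ)
    × (T ⊨[ k * N ] φ → ∀ (M : ℕ) → M ≤ k → (E : Env m n M) → L[ E ] T ⊆ φ)
proposition1 m n φ k N T =
  boundedEnvironments⇒lassoPrecise φ k T , lassoPrecise⇒boundedEnvironments φ k T
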